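{- Let $G$ be a finite simple graph of order $n_G$. Then $A_b(G)=n_G$ if and only if $G\cong K_{n_G}$.
   Context: All graphs are finite and simple. A (proper) $k$-coloring of $G$ is a map $c:V(G)\to[k]$ with $c(x)\neq c(y)$ for every edge $xy$, all $k$ colors used; color classes $V_i=c^{ -1}(i)$, $V_{i,j}=V_i\cup V_j$. A coloring is acyclic if $G[V_{i,j}]$ is a forest for all $i,j$. $CN_c[v]$ is the set of colors on $v$ and its neighbors; $v$ is a b-vertex if $CN_c[v]=[k]$. A recoloring step applied to a $k$-coloring $c$ and a color $i$ having no b-vertex recolors every $v\in V_i$ with some color of $[k]\setminus CN_c[v]$, producing a $(k-1)$-coloring $c'$; if $c,c'$ are acyclic it is an acyclic recoloring step, written $c'\triangleleft_a c$. Let $\prec_a$ be the transitive closure of $\triangleleft_a$, a strict partial order on the set of acyclic colorings of $G$; an acyclic coloring is minimal for $\prec_a$ iff no acyclic recoloring step can be applied to it. The acyclic b-chromatic number $A_b(G)$ is the maximum number of colors of a minimal element of $\prec_a$. -}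

module Defs where

open import Data.Nat using (ℕ; zero; suc; _≤_; _+_)
open import Data.Fin using (Fin; zero; suc; inject₁; fromℕ; punchIn)
open import Data.Bool using (Bool; true; false)
open import Data.Product using (Σ; ∃; _×_; _,_)
open import Data.Empty using (⊥)
open import Relation.Nullary using (¬_; does)
open import Relation.Binary.PropositionalEquality using (_≡_; _≢_)
open import Function.Definitions using (Injective)
open import Function.Bundles using (_↔_; Inverse)
open import Data.Fin.Properties using (_≟_)

record Graph (n : ℕ) : Set where
  field
    adj     : Fin n → Fin n → Bool
    symm    : ∀ x y → adj x y ≡ adj y x
    irrefl  : ∀ x → adj x x ≡ false
open Graph public

K : (n : ℕ) → Graph n
K n = record { adj = λ x y → Data.Bool.not (does (x ≟ y))
             ; symm = λ x y → symm' x y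
             ; irrefl = λ x → irr x }
  where
  open import Relation.Binary.PropositionalEquality using (refl; sym)
  open import Relation.Nullary using (yes; no)
  open import Data.Bool using (not)
  symm' : ∀ (x y : Fin n) → not (does (x ≟ y)) ≡ not (does (y ≟ x))
  symm' x y with x ≟ y | y ≟ x
  ... | yes _ | yes _ = refl
  ... | no _  | no _  = refl
  ... | yes p | no q  = Data.Empty.⊥-elim (q (sym p))
  ... | no p  | yes q = Data.Empty.⊥-elim (p (sym q))
  irr : ∀ (x : Fin n) → not (does (x ≟ x)) ≡ false
  irr x with x ≟ x
  ... | yes _ = refl
  ... | no p  = Data.Empty.⊥-elim (p refl)

record _≅_ {n m : ℕ} (G : Graph n) (H : Graph m) : Set where
  field
    bij      : Fin n ↔ Fin m
    preserve : ∀ x y → adj G x y ≡ adj H (Inverse.to bij x) (Inverse.to bij y)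

module _ {n : ℕ} (G : Graph n) where

  record Coloring (k : ℕ) : Set where
    field
      col     : Fin n → Fin k
      proper  : ∀ x y → adj G x y ≡ true → col x ≢ col y
      surj    : ∀ (i : Fin k) → ∃ λ x → col x ≡ i
  open Coloring public

  record CycleIn (S : Fin n → Set) : Set where
    field
      len   : ℕ
      vtx   : Fin (3 + len) → Fin n
      inj   : Injective _≡_ _≡_ vtx
      inS   : ∀ l → S (vtx l)
      step  : ∀ (l : Fin (2 + len)) → adj G (vtx (inject₁ l)) (vtx (suc l)) ≡ true
      close : adj G (vtx (fromℕ (2 + len))) (vtx zero) ≡ true

  ForestOn : (Fin n → Set) → Set
  ForestOn S = ¬ CycleIn S

  Acyclic : ∀ {k} → Coloring k → Set
  Acyclic {k} c = ∀ (i j : Fin k) → ForestOn (λ v → (col c v ≡ i) Data.Sum.⊎ (col c v ≡ j))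
    where import Data.Sum

  InCN : ∀ {k} → Coloring k → Fin n → Fin k → Set
  InCN c v j = (col c v ≡ j) Data.Sum.⊎ (∃ λ u → (adj G v u ≡ true) × (col c u ≡ j))
    where import Data.Sum

  BVertex : ∀ {k} → Coloring k → Fin n → Set
  BVertex {k} c v = ∀ (j : Fin k) → InCN c v j

  -- The remaining k colors are
  -- relabelled onto Fin k via punchIn i (order-preserving removal of i).
  RecolorStep : ∀ {k} → Coloring (suc k) → Fin (suc k) → Coloring k → Set
  RecolorStep c i c' =
    (∀ v → col c v ≡ i → ¬ BVertex c v) ×
    (∀ v → (col c v ≢ i → punchIn i (col c' v) ≡ col c v) ×
           (col c v ≡ i → ¬ InCN c v (punchIn i (col c' v))))

  AcyclicStep : ∀ {k} → Coloring k → Coloring (suc k) → Set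
  AcyclicStep c' c = Acyclic c × Acyclic c' × ∃ λ i → RecolorStep c i c'

  Minimal : ∀ {k} → Coloring k → Set
  Minimal {zero}  c = Acyclic c
  Minimal {suc k} c = Acyclic c × ¬ (∃ λ (c' : Coloring k) → AcyclicStep c' c)

  AbIs : ℕ → Set
  AbIs k = (∃ λ (c : Coloring k) → Minimal c) ×
           (∀ k' (c : Coloring k') → Minimal c → k' ≤ k)

-- If A_b(G) = n, a minimal acyclic coloring with n colors exists; having as many
-- colors as vertices it is injective, so two non-adjacent vertices x, y would let
-- x move into the color of y.  Every color then appears at most once except that
-- of y, which rules out bicolored cycles, so this is an acyclic recoloring step,
-- contradicting minimality.  Conversely, an injective coloring of K_n is acyclic
-- and every vertex is a b-vertex, so it is minimal; no coloring has more than n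
-- colors.
module Submission where

open import Defs
open import Data.Nat using (ℕ; zero; suc; _≤_; _+_)
open import Data.Nat.Properties using (1+n≰n)
open import Data.Fin using (Fin; zero; suc; fromℕ; punchIn; punchOut)
open import Data.Fin.Properties
  using (_≟_; any?; injective⇒≤; punchOut-cong; punchOut-injective; punchIn-punchOut;
         punchOut-punchIn; punchInᵢ≢i)
open import Data.Bool using (true; false; not)
open import Data.Product using (∃; _×_; _,_; proj₁; proj₂)
open import Data.Sum using (_⊎_; inj₁; inj₂)
open import Function.Base using (_∘_)
open import Function.Bundles using (_⇔_; mk⇔; Inverse; Injection)
open import Function.Properties.Inverse using (Inverse⇒Injection)
open import Function.Construct.Identity using (↔-id)
open import Function.Definitions using (Injective)
open import Relation.Nullary using (¬_; does; yes; no; contradiction)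
open import Relation.Binary.PropositionalEquality
  using (_≡_; _≢_; refl; sym; trans; cong; subst)

injective⇒surjective : ∀ {m} {g : Fin m → Fin m} → Injective _≡_ _≡_ g →
                       ∀ a → ∃ λ j → g j ≡ a
injective⇒surjective {suc m} {g} g-injective a with any? (λ j → g j ≟ a)
... | yes hit = hit
... | no miss = contradiction (injective⇒≤ punchOut∘g-injective) 1+n≰n
  where
  a≢g : ∀ j → a ≢ g j
  a≢g j a≡gj = miss (j , sym a≡gj)

  punchOut∘g-injective : Injective _≡_ _≡_ (λ j → punchOut (a≢g j))
  punchOut∘g-injective = g-injective ∘ punchOut-injective (a≢g _) (a≢g _)

section-injective : ∀ {a b} {A : Set a} {B : Set b} {f : A → B}
                    (f-surjective : ∀ y → ∃ λ x → f x ≡ y) →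
                    Injective _≡_ _≡_ (proj₁ ∘ f-surjective)
section-injective {f = f} f-surjective {y} {y′} eq =
  trans (sym (proj₂ (f-surjective y))) (trans (cong f eq) (proj₂ (f-surjective y′)))

surjective⇒injective : ∀ {m} {f : Fin m → Fin m} → (∀ i → ∃ λ x → f x ≡ i) →
                       Injective _≡_ _≡_ f
surjective⇒injective {m} {f} f-surjective {a} {b} fa≡fb =
  trans (sym (section-retracts a)) (trans (cong section fa≡fb) (section-retracts b))
  where
  section : Fin m → Fin m
  section = proj₁ ∘ f-surjective

  section-retracts : ∀ a → section (f a) ≡ a
  section-retracts a with injective⇒surjective (section-injective f-surjective) a
  ... | j , section-j≡a =
    trans (cong section (trans (cong f (sym section-j≡a)) (proj₂ (f-surjective j)))) section-j≡a

alternate : ∀ {m} {i j p q r : Fin m} → (p ≡ i ⊎ p ≡ j) → (q ≡ i ⊎ q ≡ j) → (r ≡ i ⊎ r ≡ j) →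
            p ≢ q → q ≢ r → p ≡ r
alternate (inj₁ refl) (inj₁ refl) _           p≢q _   = contradiction refl p≢q
alternate (inj₂ refl) (inj₂ refl) _           p≢q _   = contradiction refl p≢q
alternate _           (inj₁ refl) (inj₁ refl) _   q≢r = contradiction refl q≢r
alternate _           (inj₂ refl) (inj₂ refl) _   q≢r = contradiction refl q≢r
alternate (inj₁ refl) (inj₂ refl) (inj₁ refl) _   _   = refl
alternate (inj₂ refl) (inj₁ refl) (inj₂ refl) _   _   = refl

false≢true : false ≢ true
false≢true ()

K-adj : ∀ {n} {a b : Fin n} → a ≢ b → adj (K n) a b ≡ true
K-adj {a = a} {b} a≢b with a ≟ b
... | yes a≡b = contradiction a≡b a≢b
... | no _    = refl

K-adj⇒≢ : ∀ {n} {a b : Fin n} → adj (K n) a b ≡ true → a ≢ b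
K-adj⇒≢ {a = a} {b} ab with a ≟ b
K-adj⇒≢ () | yes _
... | no a≢b = a≢b

complete⇒≅K : ∀ {n} (G : Graph n) → (∀ x y → x ≢ y → adj G x y ≡ true) → G ≅ K n
complete⇒≅K G complete = record { bij = ↔-id _ ; preserve = preserve }
  where
  preserve : ∀ x y → adj G x y ≡ not (does (x ≟ y))
  preserve x y with x ≟ y
  ... | yes refl = irrefl G x
  ... | no x≢y   = complete x y x≢y

module _ {n : ℕ} (G : Graph n) where

  adj-irrefl : ∀ {v} → adj G v v ≢ true
  adj-irrefl {v} = false≢true ∘ trans (sym (irrefl G v))

  colors≤order : ∀ {k} → Coloring G k → k ≤ n
  colors≤order c = injective⇒≤ (section-injective (surj c))

  AtMostOneRepeatedColor : ∀ {k} → Coloring G k → Set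
  AtMostOneRepeatedColor c = ∀ {a a′ b b′} → a ≢ a′ → col c a ≡ col c a′ →
                             b ≢ b′ → col c b ≡ col c b′ → col c a ≡ col c b

  -- On a bicolored cycle v₀ v₁ v₂ … vₗ, both v₀,v₂ and vₗ,v₁ repeat a color, and
  -- these colors differ since vₗ v₀ is an edge.
  atMostOneRepeatedColor⇒acyclic : ∀ {k} (c : Coloring G k) →
                                   AtMostOneRepeatedColor c → Acyclic G c
  atMostOneRepeatedColor⇒acyclic c once i j cycle =
    proper c vₗ v₀ close (sym (once v₀≢v₂ v₀∼v₂ vₗ≢v₁ vₗ∼v₁))
    where
    open CycleIn cycle
    v₀ v₁ v₂ vₗ : Fin n
    v₀ = vtx zero
    v₁ = vtx (suc zero)
    v₂ = vtx (suc (suc zero))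
    vₗ = vtx (fromℕ (2 + len))

    v₀∼v₂ : col c v₀ ≡ col c v₂
    v₀∼v₂ = alternate (inS _) (inS _) (inS _)
                      (proper c _ _ (step zero)) (proper c _ _ (step (suc zero)))

    vₗ∼v₁ : col c vₗ ≡ col c v₁
    vₗ∼v₁ = alternate (inS _) (inS _) (inS _)
                      (proper c _ _ close) (proper c _ _ (step zero))

    v₀≢v₂ : v₀ ≢ v₂
    v₀≢v₂ eq with inj eq
    ... | ()

    vₗ≢v₁ : vₗ ≢ v₁
    vₗ≢v₁ eq with inj eq
    ... | ()

  injective⇒acyclic : ∀ {k} (c : Coloring G k) → Injective _≡_ _≡_ (col c) → Acyclic G c
  injective⇒acyclic c c-injective =
    atMostOneRepeatedColor⇒acyclic c λ a≢a′ a∼a′ _ _ → contradiction (c-injective a∼a′) a≢a′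

  everyClassHasBVertex⇒minimal : ∀ {k} (c : Coloring G k) → Acyclic G c →
                                 (∀ i → ∃ λ v → col c v ≡ i × BVertex G c v) → Minimal G c
  everyClassHasBVertex⇒minimal {zero}  c acyclic _         = acyclic
  everyClassHasBVertex⇒minimal {suc k} c acyclic bVertices =
    acyclic , λ { (_ , _ , _ , i , noBVertex , _) →
                  let v , v∈Vᵢ , b = bVertices i in noBVertex v v∈Vᵢ b }

module MergeNonAdjacent {n k : ℕ} (G : Graph n) (c : Coloring G (suc k))
                        (c-injective : Injective _≡_ _≡_ (col c))
                        {x y : Fin n} (x≢y : x ≢ y) (x≁y : adj G x y ≡ false) where

  i : Fin (suc k)
  i = col c x

  merge : Fin n → Fin n
  merge v with v ≟ x
  ... | yes _ = y
  ... | no _  = v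

  merge-x : merge x ≡ y
  merge-x with x ≟ x
  ... | yes _   = refl
  ... | no x≢x  = contradiction refl x≢x

  merge-≢x : ∀ {v} → v ≢ x → merge v ≡ v
  merge-≢x {v} v≢x with v ≟ x
  ... | yes v≡x = contradiction v≡x v≢x
  ... | no _    = refl

  merge≢x : ∀ v → merge v ≢ x
  merge≢x v with v ≟ x
  ... | yes _   = x≢y ∘ sym
  ... | no v≢x  = v≢x

  ¬adj-xy : adj G x y ≢ true
  ¬adj-xy = false≢true ∘ trans (sym x≁y)

  merge-separates-adjacent : ∀ {v w} → adj G v w ≡ true → merge v ≢ merge w
  merge-separates-adjacent {v} {w} vw with v ≟ x | w ≟ x
  ... | yes refl | yes refl = λ _ → adj-irrefl G vw
  ... | yes refl | no _     = λ { refl → ¬adj-xy vw }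
  ... | no _     | yes refl = λ { refl → ¬adj-xy (trans (symm G x v) vw) }
  ... | no _     | no _     = λ { refl → adj-irrefl G vw }

  merge-collision : ∀ {v w} → v ≢ w → merge v ≡ merge w → merge v ≡ y
  merge-collision {v} {w} v≢w with v ≟ x | w ≟ x
  ... | yes refl | yes refl = λ _ → contradiction refl v≢w
  ... | yes _    | no _     = λ _ → refl
  ... | no _     | yes _    = λ eq → eq
  ... | no _     | no _     = λ eq → contradiction eq v≢w

  i≢merged : ∀ v → i ≢ col c (merge v)
  i≢merged v = merge≢x v ∘ c-injective ∘ sym

  col′ : Fin n → Fin k
  col′ v = punchOut (i≢merged v)

  punchIn-col′ : ∀ v → punchIn i (col′ v) ≡ col c (merge v)
  punchIn-col′ v = punchIn-punchOut (i≢merged v)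

  col′≡⇒merge≡ : ∀ {v w} → col′ v ≡ col′ w → merge v ≡ merge w
  col′≡⇒merge≡ {v} {w} = c-injective ∘ punchOut-injective (i≢merged v) (i≢merged w)

  merge≡⇒col′≡ : ∀ {v w} → merge v ≡ merge w → col′ v ≡ col′ w
  merge≡⇒col′≡ = punchOut-cong i ∘ cong (col c)

  col′-surjective : ∀ j → ∃ λ v → col′ v ≡ j
  col′-surjective j with surj c (punchIn i j)
  ... | v , cv≡ = v , trans (punchOut-cong i (trans (cong (col c) (merge-≢x v≢x)) cv≡))
                            (punchOut-punchIn i)
    where
    v≢x : v ≢ x
    v≢x v≡x = punchInᵢ≢i i j (trans (sym cv≡) (cong (col c) v≡x))

  c′ : Coloring G k
  c′ = record
    { col    = col′
    ; proper = λ v w vw → merge-separates-adjacent vw ∘ col′≡⇒merge≡ {v} {w}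
    ; surj   = col′-surjective
    }

  c′-acyclic : Acyclic G c′
  c′-acyclic = atMostOneRepeatedColor⇒acyclic G c′
    λ {a} {a′} {b} {b′} a≢a′ a∼a′ b≢b′ b∼b′ →
      merge≡⇒col′≡ {a} {b}
        (trans (merge-collision a≢a′ (col′≡⇒merge≡ {a} {a′} a∼a′))
               (sym (merge-collision b≢b′ (col′≡⇒merge≡ {b} {b′} b∼b′))))

  y-color∉CN[x] : ¬ InCN G c x (col c y)
  y-color∉CN[x] (inj₁ cx≡cy)          = x≢y (c-injective cx≡cy)
  y-color∉CN[x] (inj₂ (u , xu , cu≡cy)) with c-injective cu≡cy
  ... | refl = ¬adj-xy xu

  recolorStep : RecolorStep G c i c′
  recolorStep = noBVertex , λ v → keep v , moved v
    where
    noBVertex : ∀ v → col c v ≡ i → ¬ BVertex G c v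
    noBVertex v cv≡i b with c-injective cv≡i
    ... | refl = y-color∉CN[x] (b (col c y))

    keep : ∀ v → col c v ≢ i → punchIn i (col′ v) ≡ col c v
    keep v cv≢i = trans (punchIn-col′ v) (cong (col c) (merge-≢x (cv≢i ∘ cong (col c))))

    moved : ∀ v → col c v ≡ i → ¬ InCN G c v (punchIn i (col′ v))
    moved v cv≡i with c-injective cv≡i
    ... | refl = y-color∉CN[x] ∘ subst (InCN G c x) (trans (punchIn-col′ x) (cong (col c) merge-x))

minimal⇒complete : ∀ {k} (G : Graph (suc k)) (c : Coloring G (suc k)) → Minimal G c →
                   ∀ x y → x ≢ y → adj G x y ≡ true
minimal⇒complete G c (c-acyclic , noStep) x y x≢y with adj G x y in x≁y
... | true  = refl
... | false = contradiction (c′ , c-acyclic , c′-acyclic , i , recolorStep) noStep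
  where open MergeNonAdjacent G c (surjective⇒injective (surj c)) x≢y x≁y

≅K⇒AbIs : ∀ {n} (G : Graph n) → G ≅ K n → AbIs G n
≅K⇒AbIs {n} G iso = (c , everyClassHasBVertex⇒minimal G c acyclic bVertices) , colors
  where
  open _≅_ iso
  open Inverse bij using (to; from; strictlyInverseˡ)

  to-injective : Injective _≡_ _≡_ to
  to-injective = Injection.injective (Inverse⇒Injection bij)

  ≢⇒adj : ∀ {v w} → to v ≢ to w → adj G v w ≡ true
  ≢⇒adj {v} {w} tv≢tw = trans (preserve v w) (K-adj tv≢tw)

  c : Coloring G n
  c = record
    { col    = to
    ; proper = λ v w vw → K-adj⇒≢ (trans (sym (preserve v w)) vw)
    ; surj   = λ j → from j , strictlyInverseˡ j
    }

  acyclic : Acyclic G c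
  acyclic = injective⇒acyclic G c to-injective

  bVertex : ∀ v → BVertex G c v
  bVertex v j with to v ≟ j
  ... | yes tv≡j = inj₁ tv≡j
  ... | no tv≢j  =
    inj₂ (from j , ≢⇒adj (tv≢j ∘ λ tv≡tfj → trans tv≡tfj (strictlyInverseˡ j)) , strictlyInverseˡ j)

  bVertices : ∀ j → ∃ λ v → to v ≡ j × BVertex G c v
  bVertices j = from j , strictlyInverseˡ j , bVertex (from j)

  colors : ∀ k (c′ : Coloring G k) → Minimal G c′ → k ≤ n
  colors _ c′ _ = colors≤order G c′

AbIs⇒≅K : ∀ {n} (G : Graph n) → AbIs G n → G ≅ K n
AbIs⇒≅K {zero}  G _                   = complete⇒≅K G λ ()
AbIs⇒≅K {suc k} G ((c , minimal) , _) = complete⇒≅K G (minimal⇒complete G c minimal)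

proposition3 : ∀ (n : ℕ) (G : Graph n) → AbIs G n ⇔ (G ≅ K n)
proposition3 n G = mk⇔ (AbIs⇒≅K G) (≅K⇒AbIs G)
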